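{- Let $m,n\geq 2$ and let $S\subseteq V(K_n\,\square\,K_m)$. Then $S$ resolves $K_n\,\square\,K_m$ if and only if all of the following hold: (a) there is at most one empty row and at most one empty column; (b) there is at most one lonely vertex; (c) if there is an empty row and an empty column, then there is no lonely vertex.
   Context: $K_n$ is the complete graph on $n$ vertices. The cartesian product $G\,\square\,H$ has vertex set $V(G)\times V(H)$, with $(a,v)\sim(b,w)$ iff ($a=b$ and $vw\in E(H)$) or ($v=w$ and $ab\in E(G)$). In $K_n\,\square\,K_m$, a row is a set $\{(a,v):a\in V(K_n)\}$ for fixed $v\in V(K_m)$ and a column is a set $\{(a,v):v\in V(K_m)\}$ for fixed $a\in V(K_n)$; two distinct vertices are adjacent iff they lie in a common row or column, and otherwise are at distance $2$. With respect to $S$, a row or column is empty if it contains no vertex of $S$, and a vertex of $S$ is lonely if it is the only vertex of $S$ in its row and the only vertex of $S$ in its column. A vertex $x$ resolves $v,w$ if $d(v,x)\neq d(w,x)$; a set resolves a graph if every pair of distinct vertices is resolved by some vertex of the set. -}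

module Defs where

open import Data.Nat using (ℕ)
open import Data.Bool using (Bool; true)
open import Data.Fin using (Fin)
open import Data.Fin.Properties using (_≟_)
open import Data.Product using (_×_; _,_; ∃; Σ)
open import Data.Sum using (_⊎_)
open import Relation.Nullary using (¬_; yes; no)
open import Relation.Binary.PropositionalEquality using (_≡_; _≢_)

Vertex : ℕ → ℕ → Set
Vertex n m = Fin n × Fin m

Adj : ∀ {n m} → Vertex n m → Vertex n m → Set
Adj (a , v) (b , w) = (a ≡ b × v ≢ w) ⊎ (v ≡ w × a ≢ b)

dist : ∀ {n m} → Vertex n m → Vertex n m → ℕ
dist (a , v) (b , w) with a ≟ b | v ≟ w
... | yes _ | yes _ = 0
... | yes _ | no _  = 1
... | no _  | yes _ = 1
... | no _  | no _  = 2

-- A set of vertices of the (finite) graph, given by its characteristic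
-- function; membership x ∈ S is  S x ≡ true  (decidable, as for a finite subset).
VSet : ℕ → ℕ → Set
VSet n m = Vertex n m → Bool

_∈S_ : ∀ {n m} → Vertex n m → VSet n m → Set
x ∈S S = S x ≡ true

Resolves : ∀ {n m} → Vertex n m → Vertex n m → Vertex n m → Set
Resolves x v w = dist v x ≢ dist w x

IsResolving : ∀ {n m} → VSet n m → Set
IsResolving {n} {m} S =
  ∀ (v w : Vertex n m) → v ≢ w → ∃ λ x → x ∈S S × Resolves x v w

-- Row v = {(a , v) : a ∈ Fin n}; column a = {(a , v) : v ∈ Fin m}.
EmptyRow : ∀ {n m} → VSet n m → Fin m → Set
EmptyRow {n} S v = ∀ (a : Fin n) → ¬ ((a , v) ∈S S)

EmptyCol : ∀ {n m} → VSet n m → Fin n → Set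
EmptyCol {m = m} S a = ∀ (v : Fin m) → ¬ ((a , v) ∈S S)

Lonely : ∀ {n m} → VSet n m → Vertex n m → Set
Lonely {n} {m} S (a , v) =
  (a , v) ∈S S
  × (∀ (b : Fin n) → (b , v) ∈S S → b ≡ a)
  × (∀ (w : Fin m) → (a , w) ∈S S → w ≡ v)

CondA : ∀ {n m} → VSet n m → Set
CondA {n} {m} S =
  (∀ (v w : Fin m) → EmptyRow S v → EmptyRow S w → v ≡ w)
  × (∀ (a b : Fin n) → EmptyCol S a → EmptyCol S b → a ≡ b)

CondB : ∀ {n m} → VSet n m → Set
CondB {n} {m} S = ∀ (x y : Vertex n m) → Lonely S x → Lonely S y → x ≡ y

CondC : ∀ {n m} → VSet n m → Set
CondC {n} {m} S =
  (Σ (Fin m) (EmptyRow S)) → (Σ (Fin n) (EmptyCol S)) →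
  ∀ (x : Vertex n m) → ¬ Lonely S x

{-# OPTIONS --safe #-}
-- Distances in K_n □ K_m are sums of distances in K_n and K_m, so the pairs S
-- fails to resolve can be listed. Two vertices of a column are unresolved iff
-- both their rows are empty (dually for rows). Vertices (a , v), (b , w) in
-- different rows and columns are unresolved iff both corners (a , w), (b , v)
-- are secluded: no other vertex of S shares a row or column with them. A
-- secluded vertex is lonely or lies in an empty row and an empty column, so
-- (b) excludes two lonely corners, (c) one of each kind, and (a) two empty ones.
module Submission where

open import Defs
open import Data.Bool using (true)
import Data.Bool as Bool
open import Data.Empty using (⊥; ⊥-elim)
open import Data.Fin using (Fin; zero)
open import Data.Fin.Properties using (_≟_; any?)
open import Data.Nat using (ℕ; suc; _≥_; _+_; _≤_; z≤n; s≤s)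
import Data.Nat as ℕ
open import Data.Nat.Properties using (+-comm; +-identityʳ; +-cancelˡ-≡; +-cancelʳ-≡; n≤0⇒n≡0)
open import Data.Product using (_×_; _,_; proj₁; proj₂; uncurry)
open import Function using (_∘_)
open import Function.Bundles using (_⇔_; mk⇔; module Equivalence)
open Equivalence using (to; from)
open import Relation.Nullary using (¬_; yes; no)
open import Relation.Nullary.Decidable using (_×-dec_; ¬?; decidable-stable)
open import Relation.Binary.PropositionalEquality
  using (_≡_; _≢_; refl; sym; trans; cong; cong₂; subst; ≢-sym; module ≡-Reasoning)

open ≡-Reasoning

private
  variable
    k : ℕ
    a b c : Fin k
    l : ℕ
    v w u : Fin l

distK : Fin k → Fin k → ℕ
distK a b with a ≟ b
... | yes _ = 0
... | no _  = 1

distK-refl : distK a a ≡ 0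
distK-refl {a = a} with a ≟ a
... | yes _  = refl
... | no a≢a = ⊥-elim (a≢a refl)

distK-≢ : a ≢ b → distK a b ≡ 1
distK-≢ {a = a} {b = b} a≢b with a ≟ b
... | yes a≡b = ⊥-elim (a≢b a≡b)
... | no _    = refl

distK≡0⇒≡ : distK a b ≡ 0 → a ≡ b
distK≡0⇒≡ {a = a} {b = b} _ with a ≟ b
distK≡0⇒≡ _  | yes a≡b = a≡b
distK≡0⇒≡ () | no _

distK≤1 : distK a b ≤ 1
distK≤1 {a = a} {b = b} with a ≟ b
... | yes _ = z≤n
... | no _  = s≤s z≤n

≢⇒distK≡ : a ≢ c → b ≢ c → distK a c ≡ distK b c
≢⇒distK≡ a≢c b≢c = trans (distK-≢ a≢c) (sym (distK-≢ b≢c))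

suc-distK≡distK⇒≡ : suc (distK a c) ≡ distK b c → a ≡ c
suc-distK≡distK⇒≡ eq =
  distK≡0⇒≡ (n≤0⇒n≡0 (ℕ.s≤s⁻¹ (subst (_≤ 1) (sym eq) distK≤1)))

dist≡distK+distK : ∀ {n m} (a c : Fin n) (v u : Fin m) →
                   dist (a , v) (c , u) ≡ distK a c + distK v u
dist≡distK+distK a c v u with a ≟ c | v ≟ u
... | yes _ | yes _ = refl
... | yes _ | no _  = refl
... | no _  | yes _ = refl
... | no _  | no _  = refl

equidistant⇒sums : dist (a , v) (c , u) ≡ dist (b , w) (c , u) →
                   distK a c + distK v u ≡ distK b c + distK w u
equidistant⇒sums {a = a} {v = v} {c = c} {u = u} {b = b} {w = w} eq =
  trans (sym (dist≡distK+distK a c v u)) (trans eq (dist≡distK+distK b c w u))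

sums⇒equidistant : distK a c + distK v u ≡ distK b c + distK w u →
                   dist (a , v) (c , u) ≡ dist (b , w) (c , u)
sums⇒equidistant {a = a} {c = c} {v = v} {u = u} {b = b} {w = w} eq =
  trans (dist≡distK+distK a c v u) (trans eq (sym (dist≡distK+distK b c w u)))

corner-equidistant : a ≢ b → v ≢ w → dist (a , v) (a , w) ≡ dist (b , w) (a , w)
corner-equidistant {a = a} {b = b} {v = v} {w = w} a≢b v≢w = sums⇒equidistant (begin
  distK a a + distK v w  ≡⟨ cong₂ _+_ distK-refl (distK-≢ v≢w) ⟩
  1                      ≡⟨ sym (cong₂ _+_ (distK-≢ (≢-sym a≢b)) distK-refl) ⟩
  distK b a + distK w w  ∎)

Unresolved : ∀ {n m} → VSet n m → Vertex n m → Vertex n m → Set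
Unresolved S p q = ∀ x → x ∈S S → dist p x ≡ dist q x

-- Lonely S x unfolds to x ∈S S × Secluded S x.
Secluded : ∀ {n m} → VSet n m → Vertex n m → Set
Secluded S (a , v) =
  (∀ b → (b , v) ∈S S → b ≡ a) × (∀ w → (a , w) ∈S S → w ≡ v)

module _ {n m : ℕ} (S : VSet n m) where

  private
    variable
      p q : Vertex n m

  unresolved-sym : Unresolved S p q → Unresolved S q p
  unresolved-sym U x x∈ = sym (U x x∈)

  resolving⇒¬unresolved : IsResolving S → p ≢ q → ¬ Unresolved S p q
  resolving⇒¬unresolved R p≢q U with R _ _ p≢q
  ... | x , x∈ , x-resolves = x-resolves (U x x∈)

  ¬unresolved⇒resolving : (∀ p q → p ≢ q → ¬ Unresolved S p q) → IsResolving S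
  ¬unresolved⇒resolving all-resolved p q p≢q
    with any? (λ a → any? λ v →
           (S (a , v) Bool.≟ true) ×-dec ¬? (dist p (a , v) ℕ.≟ dist q (a , v)))
  ... | yes (a , v , resolver) = (a , v) , resolver
  ... | no ∄resolver = ⊥-elim (all-resolved p q p≢q λ (a , v) x∈ →
          decidable-stable (dist p (a , v) ℕ.≟ dist q (a , v)) λ d≢ → ∄resolver (a , v , x∈ , d≢))

  unresolved-column-pair⇒empty-row : v ≢ w → Unresolved S (a , v) (a , w) → EmptyRow S v
  unresolved-column-pair⇒empty-row {v = v} {w = w} {a = a} v≢w U c c∈ =
    v≢w (sym (distK≡0⇒≡ (begin
    distK w v  ≡⟨ +-cancelˡ-≡ (distK a c) _ _ (sym (equidistant⇒sums (U (c , v) c∈))) ⟩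
    distK v v  ≡⟨ distK-refl ⟩
    0          ∎)))

  unresolved-column-pair⇔empty-rows : v ≢ w →
    Unresolved S (a , v) (a , w) ⇔ (EmptyRow S v × EmptyRow S w)
  unresolved-column-pair⇔empty-rows {a = a} v≢w = mk⇔
    (λ U → unresolved-column-pair⇒empty-row v≢w U
         , unresolved-column-pair⇒empty-row (≢-sym v≢w) (unresolved-sym U))
    (λ (empty-v , empty-w) (c , u) c∈ → sums⇒equidistant (cong (distK a c +_)
      (≢⇒distK≡ (λ { refl → empty-v c c∈ }) (λ { refl → empty-w c c∈ }))))

  unresolved-row-pair⇒empty-column : a ≢ b → Unresolved S (a , v) (b , v) → EmptyCol S a
  unresolved-row-pair⇒empty-column {a = a} {b = b} {v = v} a≢b U u u∈ =
    a≢b (sym (distK≡0⇒≡ (begin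
    distK b a  ≡⟨ +-cancelʳ-≡ _ (distK b a) (distK a a) (sym (equidistant⇒sums (U (a , u) u∈))) ⟩
    distK a a  ≡⟨ distK-refl ⟩
    0          ∎)))

  unresolved-row-pair⇔empty-columns : a ≢ b →
    Unresolved S (a , v) (b , v) ⇔ (EmptyCol S a × EmptyCol S b)
  unresolved-row-pair⇔empty-columns {v = v} a≢b = mk⇔
    (λ U → unresolved-row-pair⇒empty-column a≢b U
         , unresolved-row-pair⇒empty-column (≢-sym a≢b) (unresolved-sym U))
    (λ (empty-a , empty-b) (c , u) c∈ → sums⇒equidistant (cong (_+ distK v u)
      (≢⇒distK≡ (λ { refl → empty-a u c∈ }) (λ { refl → empty-b u c∈ }))))

  unresolved⇒secluded-corner : a ≢ b → v ≢ w → Unresolved S (a , v) (b , w) → Secluded S (a , w)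
  unresolved⇒secluded-corner {a = a} {b = b} {v = v} {w = w} a≢b v≢w U = in-row , in-column
    where
    in-row : ∀ c → (c , w) ∈S S → c ≡ a
    in-row c c∈ = sym (suc-distK≡distK⇒≡ (begin
      suc (distK a c)        ≡⟨ +-comm 1 (distK a c) ⟩
      distK a c + 1          ≡⟨ cong (distK a c +_) (sym (distK-≢ v≢w)) ⟩
      distK a c + distK v w  ≡⟨ equidistant⇒sums (U (c , w) c∈) ⟩
      distK b c + distK w w  ≡⟨ cong (distK b c +_) distK-refl ⟩
      distK b c + 0          ≡⟨ +-identityʳ (distK b c) ⟩
      distK b c              ∎))
    in-column : ∀ u → (a , u) ∈S S → u ≡ w
    in-column u u∈ = sym (suc-distK≡distK⇒≡ (begin
      suc (distK w u)        ≡⟨ cong (_+ distK w u) (sym (distK-≢ (≢-sym a≢b))) ⟩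
      distK b a + distK w u  ≡⟨ sym (equidistant⇒sums (U (a , u) u∈)) ⟩
      distK a a + distK v u  ≡⟨ cong (_+ distK v u) distK-refl ⟩
      distK v u              ∎))

  secluded-corners⇒unresolved : a ≢ b → v ≢ w → Secluded S (a , w) → Secluded S (b , v) →
                                Unresolved S (a , v) (b , w)
  secluded-corners⇒unresolved {a = a} {b = b} a≢b v≢w
    (row-w , column-a) (row-v , column-b) (c , u) c∈
    with c ≟ a | c ≟ b
  ... | yes refl | _ rewrite column-a u c∈ = corner-equidistant a≢b v≢w
  ... | _ | yes refl rewrite column-b u c∈ = sym (corner-equidistant (≢-sym a≢b) (≢-sym v≢w))
  ... | no c≢a | no c≢b = sums⇒equidistant (cong₂ _+_
    (≢⇒distK≡ (≢-sym c≢a) (≢-sym c≢b))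
    (≢⇒distK≡ (λ { refl → c≢b (row-v c c∈) }) (λ { refl → c≢a (row-w c c∈) })))

  empty-lines⇒secluded : EmptyRow S v → EmptyCol S a → Secluded S (a , v)
  empty-lines⇒secluded empty-row empty-column =
    (λ b b∈ → ⊥-elim (empty-row b b∈)) , (λ w w∈ → ⊥-elim (empty-column w w∈))

  secluded-nonmember⇒empty-lines : Secluded S (a , v) → ¬ (a , v) ∈S S →
                                   EmptyRow S v × EmptyCol S a
  secluded-nonmember⇒empty-lines {a = a} {v = v} (in-row , in-column) a∉ =
    (λ b b∈ → a∉ (subst (λ b → (b , v) ∈S S) (in-row b b∈) b∈)) ,
    (λ w w∈ → a∉ (subst (λ w → (a , w) ∈S S) (in-column w w∈) w∈))

  resolving⇒condA : Fin n → Fin m → IsResolving S → CondA S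
  resolving⇒condA a v R = equal-empty-rows , equal-empty-columns
    where
    equal-empty-rows : ∀ w w′ → EmptyRow S w → EmptyRow S w′ → w ≡ w′
    equal-empty-rows w w′ empty empty′ = decidable-stable (w ≟ w′) λ w≢w′ →
      resolving⇒¬unresolved R (w≢w′ ∘ cong proj₂)
        (from (unresolved-column-pair⇔empty-rows {a = a} w≢w′) (empty , empty′))
    equal-empty-columns : ∀ b b′ → EmptyCol S b → EmptyCol S b′ → b ≡ b′
    equal-empty-columns b b′ empty empty′ = decidable-stable (b ≟ b′) λ b≢b′ →
      resolving⇒¬unresolved R (b≢b′ ∘ cong proj₁)
        (from (unresolved-row-pair⇔empty-columns {v = v} b≢b′) (empty , empty′))

  resolving⇒condB : IsResolving S → CondB S
  resolving⇒condB R (a , v) (b , w) (_ , x-secluded) (y∈ , y-secluded) with a ≟ b | v ≟ w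
  ... | yes refl | _ = cong (a ,_) (sym (proj₂ x-secluded w y∈))
  ... | _ | yes refl = cong (_, v) (sym (proj₁ x-secluded b y∈))
  ... | no a≢b | no v≢w = ⊥-elim (resolving⇒¬unresolved R (a≢b ∘ cong proj₁)
    (secluded-corners⇒unresolved a≢b (≢-sym v≢w) x-secluded y-secluded))

  resolving⇒condC : IsResolving S → CondC S
  resolving⇒condC R (r , empty-row) (c , empty-column) (a , v) (x∈ , x-secluded) =
    resolving⇒¬unresolved R (a≢c ∘ cong proj₁)
      (secluded-corners⇒unresolved a≢c r≢v x-secluded
        (empty-lines⇒secluded empty-row empty-column))
    where
    a≢c : a ≢ c
    a≢c refl = empty-column v x∈
    r≢v : r ≢ v
    r≢v refl = empty-row a x∈

  conditions⇒¬secluded-pair : CondA S → CondB S → CondC S → a ≢ b →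
                              Secluded S (a , v) → Secluded S (b , w) → ⊥
  conditions⇒¬secluded-pair {a = a} {b = b} {v = v} {w = w}
    (_ , equal-empty-columns) lonely-unique no-lonely a≢b x-secluded y-secluded
    with S (a , v) Bool.≟ true | S (b , w) Bool.≟ true
  ... | yes x∈ | yes y∈ =
    a≢b (cong proj₁ (lonely-unique _ _ (x∈ , x-secluded) (y∈ , y-secluded)))
  ... | yes x∈ | no y∉ =
    let empty-row , empty-column = secluded-nonmember⇒empty-lines y-secluded y∉ in
    no-lonely (w , empty-row) (b , empty-column) (a , v) (x∈ , x-secluded)
  ... | no x∉ | yes y∈ =
    let empty-row , empty-column = secluded-nonmember⇒empty-lines x-secluded x∉ in
    no-lonely (v , empty-row) (a , empty-column) (b , w) (y∈ , y-secluded)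
  ... | no x∉ | no y∉ = a≢b (equal-empty-columns a b
    (proj₂ (secluded-nonmember⇒empty-lines x-secluded x∉))
    (proj₂ (secluded-nonmember⇒empty-lines y-secluded y∉)))

  conditions⇒¬unresolved : CondA S → CondB S → CondC S → ∀ p q → p ≢ q → ¬ Unresolved S p q
  conditions⇒¬unresolved A@(equal-empty-rows , equal-empty-columns) B C (a , v) (b , w) p≢q U
    with a ≟ b | v ≟ w
  ... | yes refl | yes refl = p≢q refl
  ... | yes refl | no v≢w =
    v≢w (uncurry (equal-empty-rows v w) (to (unresolved-column-pair⇔empty-rows v≢w) U))
  ... | no a≢b | yes refl =
    a≢b (uncurry (equal-empty-columns a b) (to (unresolved-row-pair⇔empty-columns a≢b) U))
  ... | no a≢b | no v≢w = conditions⇒¬secluded-pair A B C a≢b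
    (unresolved⇒secluded-corner a≢b v≢w U)
    (unresolved⇒secluded-corner (≢-sym a≢b) (≢-sym v≢w) (unresolved-sym U))

lemma6p2 : (n m : ℕ) → n ≥ 2 → m ≥ 2 → (S : VSet n m) →
    IsResolving S ⇔ (CondA S × CondB S × CondC S)
lemma6p2 (suc n) (suc m) (s≤s _) (s≤s _) S = mk⇔
  (λ R → resolving⇒condA S zero zero R , resolving⇒condB S R , resolving⇒condC S R)
  (λ (A , B , C) → ¬unresolved⇒resolving S (conditions⇒¬unresolved S A B C))
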